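{- Let $S$ be an association scheme on a finite set $X$, $T$ a thin association scheme on a finite set $Y$, and $\phi$ a morphism from $S$ to $T$. Then the morphism $\delta$ from $S$ to $T\boxtimes S$ given by $\delta(x)=(\phi(x),x)$ for $x\in X$ and $\delta(s)=[\phi(s),s]$ for $s\in S$ (i.e. $(\phi\boxtimes\mathrm{id}_S)\circ\Delta_S$) is admissible.
   Context: An association scheme on a finite set $X$ is a partition $S$ of $X\times X$ into nonempty subsets such that $1_X=\{(x,x)\}\in S$; $s^*=\{(x,y):(y,x)\in s\}\in S$; and for $p,q,r\in S$ there is $a_{pq}^r\ge0$ with $|\{y:(x,y)\in p,(y,z)\in q\}|=a_{pq}^r$ whenever $(x,z)\in r$. $T$ is thin if $|\{z:(y,z)\in t\}|=1$ for all $y\in Y$, $t\in T$. The direct product $T\boxtimes S$ is the scheme on $Y\times X$ with elements $[t,s]=\{((y_1,x_1),(y_2,x_2)):(y_1,y_2)\in t,(x_1,x_2)\in s\}$. $\Delta_S$ is the morphism $S\to S\boxtimes S$, $x\mapsto(x,x)$, $s\mapsto[s,s]$; for morphisms $\alpha,\beta$, $\alpha\boxtimes\beta$ acts componentwise on points and on elements $[s,t]\mapsto[\alpha(s),\beta(t)]$. A morphism from $S$ on $X$ to $T$ on $Y$ is a function $\phi:X\cup S\to Y\cup T$ with $\phi(X)\subseteq Y$, $\phi(S)\subseteq T$, $(\phi(x_1),\phi(x_2))\in\phi(s)$ whenever $(x_1,x_2)\in s$; it is admissible if whenever $(\phi(x),y)\in\phi(s)$ there is $x'\in X$ with $\phi(x')=y$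 and $(x,x')\in s$. -}

module Defs where

open import Data.Nat using (ℕ)
open import Data.Fin using (Fin)
open import Data.Fin.Properties using (_≟_)
open import Data.List using (length; filter)
open import Data.List.Base using (allFin)
open import Data.Product using (Σ; ∃; _×_; _,_; proj₁; proj₂)
open import Relation.Nullary.Decidable using (_×-dec_)
open import Relation.Binary.PropositionalEquality using (_≡_)
open import Function using (_⇔_; _∘_)

count₂ : ∀ {n m k} → (Fin n → Fin m) → Fin m → (Fin n → Fin k) → Fin k → ℕ
count₂ {n} a p b q = length (filter (λ y → (a y ≟ p) ×-dec (b y ≟ q)) (allFin n))

count₁ : ∀ {n m} → (Fin n → Fin m) → Fin m → ℕ
count₁ {n} a t = length (filter (λ z → a z ≟ t) (allFin n))

-- An association scheme on the finite set X = Fin pts.  The elements of S are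
-- indexed by Fin cls; the partition of X × X is given by  rel x y = the (unique)
-- element of S containing (x , y).
record AssocScheme : Set where
  field
    pts      : ℕ
    cls      : ℕ
    rel      : Fin pts → Fin pts → Fin cls
    nonempty : ∀ (s : Fin cls) → ∃ λ x → ∃ λ y → rel x y ≡ s
    one      : Fin cls
    one-diag : ∀ x y → (rel x y ≡ one) ⇔ (x ≡ y)
    star     : Fin cls → Fin cls
    star-rel : ∀ x y → rel y x ≡ star (rel x y)
    a        : Fin cls → Fin cls → Fin cls → ℕ
    a-spec   : ∀ p q x z → count₂ (λ y → rel x y) p (λ y → rel y z) q ≡ a p q (rel x z)

open AssocScheme public

Thin : AssocScheme → Set
Thin T = ∀ (y : Fin (pts T)) (t : Fin (cls T)) → count₁ (λ z → rel T y z) t ≡ 1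

-- A "relational structure": points, elements, and membership (p₁ , p₂) ∈ e.
record RelStr : Set₁ where
  field
    Pt   : Set
    El   : Set
    _∋_,_ : El → Pt → Pt → Set

open RelStr public

⟦_⟧ : AssocScheme → RelStr
⟦ S ⟧ = record { Pt = Fin (pts S) ; El = Fin (cls S) ; _∋_,_ = λ s x y → rel S x y ≡ s }

_⊠_ : AssocScheme → AssocScheme → RelStr
T ⊠ S = record
  { Pt = Fin (pts T) × Fin (pts S)
  ; El = Fin (cls T) × Fin (cls S)
  ; _∋_,_ = λ ts p q → (rel T (proj₁ p) (proj₁ q) ≡ proj₁ ts) × (rel S (proj₂ p) (proj₂ q) ≡ proj₂ ts) }

-- a map X ∪ S → Y ∪ T, given by its two components
record Map (A B : RelStr) : Set where
  field
    onPt : Pt A → Pt B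
    onEl : El A → El B

open Map public

IsMorphism : (A B : RelStr) → Map A B → Set
IsMorphism A B f = ∀ s x₁ x₂ → (A ∋ s , x₁) x₂ → (B ∋ onEl f s , onPt f x₁) (onPt f x₂)

Admissible : (A B : RelStr) → Map A B → Set
Admissible A B f = ∀ s x y → (B ∋ onEl f s , onPt f x) y →
  ∃ λ x' → (onPt f x' ≡ y) × (A ∋ s , x) x'

_∘ₘ_ : ∀ {A B C} → Map B C → Map A B → Map A C
g ∘ₘ f = record { onPt = onPt g ∘ onPt f ; onEl = onEl g ∘ onEl f }

idₘ : ∀ (S : AssocScheme) → Map ⟦ S ⟧ ⟦ S ⟧
idₘ S = record { onPt = λ x → x ; onEl = λ s → s }

Δ : ∀ (S : AssocScheme) → Map ⟦ S ⟧ (S ⊠ S)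
Δ S = record { onPt = λ x → x , x ; onEl = λ s → s , s }

_⊠ₘ_ : ∀ {S S' T T'} → Map ⟦ S ⟧ ⟦ T ⟧ → Map ⟦ S' ⟧ ⟦ T' ⟧ → Map (S ⊠ S') (T ⊠ T')
α ⊠ₘ β = record { onPt = λ p → onPt α (proj₁ p) , onPt β (proj₂ p)
                ; onEl = λ p → onEl α (proj₁ p) , onEl β (proj₂ p) }

module Submission where

-- For admissibility, suppose ((φ x , x) , (y₁ , y₂))
-- lies in [φ s , s], i.e. (φ x , y₁) ∈ φ s and (x , y₂) ∈ s.  Then x' = y₂
-- works: δ(y₂) = (φ y₂ , y₂), and (φ x , φ y₂) ∈ φ s since φ is a morphism;
-- as T is thin, φ x has only one φ s-successor, so φ y₂ = y₁.

open import Defs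
open import Data.Product using (_×_; _,_)
open import Data.Fin using (Fin)
open import Data.Fin.Properties using (_≟_)
open import Data.List using (List; []; _∷_; length; filter; allFin)
open import Data.List.Relation.Unary.Any using (here; there)
open import Data.List.Membership.Propositional using (_∈_)
open import Data.List.Membership.Propositional.Properties using (∈-allFin; ∈-filter⁺)
open import Relation.Binary.PropositionalEquality using (_≡_; refl; sym; trans; cong)

length≡1⇒∈-unique : ∀ {A : Set} {u v : A} (xs : List A) → length xs ≡ 1 →
                     u ∈ xs → v ∈ xs → u ≡ v
length≡1⇒∈-unique (x ∷ []) refl (here u≡x) (here v≡x) = trans u≡x (sym v≡x)

count₁≡1⇒fibre-unique : ∀ {n m} (a : Fin n → Fin m) (t : Fin m) → count₁ a t ≡ 1 →
                         ∀ u v → a u ≡ t → a v ≡ t → u ≡ v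
count₁≡1⇒fibre-unique {n} a t one u v au≡t av≡t =
  length≡1⇒∈-unique (filter (λ z → a z ≟ t) (allFin n)) one
    (∈-filter⁺ (λ z → a z ≟ t) (∈-allFin u) au≡t)
    (∈-filter⁺ (λ z → a z ≟ t) (∈-allFin v) av≡t)

thin-functional : (T : AssocScheme) → Thin T →
                  ∀ {y z z' t} → rel T y z ≡ t → rel T y z' ≡ t → z ≡ z'
thin-functional T thin {y} {z} {z'} {t} =
  count₁≡1⇒fibre-unique (rel T y) t (thin y t) z z'

graphMap : (S T : AssocScheme) → Map ⟦ S ⟧ ⟦ T ⟧ → Map ⟦ S ⟧ (T ⊠ S)
graphMap S T φ = _⊠ₘ_ {S} {S} {T} {S} φ (idₘ S) ∘ₘ Δ S

graphMap-morphism : (S T : AssocScheme) (φ : Map ⟦ S ⟧ ⟦ T ⟧) →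
                    IsMorphism ⟦ S ⟧ ⟦ T ⟧ φ → IsMorphism ⟦ S ⟧ (T ⊠ S) (graphMap S T φ)
graphMap-morphism S T φ φ-mor s x₁ x₂ x₁sx₂ = φ-mor s x₁ x₂ x₁sx₂ , x₁sx₂

-- It is admissible when T is thin: the witness is the second coordinate of
-- the target, and thinness forces its image under φ to be the first one.
graphMap-admissible : (S T : AssocScheme) → Thin T → (φ : Map ⟦ S ⟧ ⟦ T ⟧) →
                      IsMorphism ⟦ S ⟧ ⟦ T ⟧ φ → Admissible ⟦ S ⟧ (T ⊠ S) (graphMap S T φ)
graphMap-admissible S T thin φ φ-mor s x (y₁ , y₂) (φx-y₁ , x-y₂) =
  y₂ , cong (_, y₂) φy₂≡y₁ , x-y₂
  where
  φy₂≡y₁ : onPt φ y₂ ≡ y₁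
  φy₂≡y₁ = thin-functional T thin (φ-mor s x y₂ x-y₂) φx-y₁

lemma7p7 : (S T : AssocScheme) → Thin T → (φ : Map ⟦ S ⟧ ⟦ T ⟧) → IsMorphism ⟦ S ⟧ ⟦ T ⟧ φ →
    IsMorphism ⟦ S ⟧ (T ⊠ S) (_⊠ₘ_ {S} {S} {T} {S} φ (idₘ S) ∘ₘ Δ S)
    × Admissible ⟦ S ⟧ (T ⊠ S) (_⊠ₘ_ {S} {S} {T} {S} φ (idₘ S) ∘ₘ Δ S)
lemma7p7 S T thin φ φ-mor =
  graphMap-morphism S T φ φ-mor , graphMap-admissible S T thin φ φ-mor
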